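{- Let $\widetilde{\mathcal{Q}}$ be an extended quiver with even vertices labeled by even cluster variables $x_1,\ldots,x_n$ and odd vertices labeled by odd variables $\xi_1,\ldots,\xi_m$, and define the differential $2$-form $$\omega_{\widetilde{\mathcal{Q}}}=\sum_{x_i\to x_j}\frac{dx_i\wedge dx_j}{x_ix_j}+\sum_{(\xi_i\to x_\ell\to\xi_j)}\frac{d(\xi_i\xi_j)\wedge dx_\ell}{x_\ell},$$ where the first sum runs over the arrows of the underlying quiver and the second over the $2$-paths of $\widetilde{\mathcal{Q}}$ (both with multiplicity). Let $\mu_k$ be the mutation at an even vertex $x_k$, producing the extended quiver $\mu_k(\widetilde{\mathcal{Q}})$ and the new variable $x_k'$ defined by $$x_kx_k'=\prod_{x_k\to x_j}x_j+\Big(1+\sum_{(\xi_i\to x_k\to\xi_j)}\xi_i\xi_j\Big)\prod_{x_i\to x_k}x_i .$$ Then, expressing $x_k$ in terms of $x_k'$ and the other variables via this relation and substituting into $\omega_{\widetilde{\mathcal{Q}}}$, one obtains exactly the form $\omega_{\mu_k(\widetilde{\mathcal{Q}})}$ written in the variables $x_1,\ldots,x_k',\ldots,x_n,\xi_1,\ldots,\xi_m$. That is, $\omega$ is invariant under mutations.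
   Context: An extended quiver consists of a finite quiver $\mathcal{Q}$ with no loops and no oriented $2$-cycles (multiple arrows allowed) on the even vertices $x_1,\ldots,x_n$, extra odd vertices $\xi_1,\ldots,\xi_m$ (no arrows among them), and a multiset of "$2$-paths" $(\xi_i\to x_k\to\xi_j)$, such that for each $k$ the set $I_k$ of starting indices and the set $J_k$ of ending indices of $2$-paths through $x_k$ are disjoint and every pair $(i,j)\in I_k\times J_k$ is joined by the same number of $2$-paths through $x_k$. The odd variables $\xi_i$ anticommute with each other (so $\xi_i^2=0$) and commute with the even ones. Mutation $\mu_k$ at $x_k$: (0) the quiver $\mathcal{Q}$ mutates classically (for every path $x_i\to x_k\to x_j$ add an arrow $x_i\to x_j$, reverse all arrows at $x_k$, remove oriented $2$-cycles pairwise); (1*) for every $2$-path $(\xi_i\to x_k\to\xi_j)$ and every arrow $x_k\to x_\ell$ of the original quiver (with multiplicity), add a $2$-path $(\xi_i\to x_\ell\to\xi_j)$; (2*) each $2$-path $(\xi_i\to x_k\to\xi_j)$ is reversed to $(\xi_j\to x_k\to\xi_i)$; (3*) $2$-paths $(\xi_i\to x_\ell\to\xi_j)$ and $(\xi_j\to x_\ell\to\xi_i)$ through the same vertex cancel pairwise. In the new extended quiver, the vertex $x_k$ is relabeled $x_k'$. -}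

module Defs where

open import Level using (Level; _⊔_) renaming (suc to lsuc)
open import Algebra.Bundles using (Ring)
open import Data.Nat using (ℕ; zero; suc; _∸_; _<_) renaming (_+_ to _+ℕ_; _*_ to _*ℕ_)
open import Data.Fin using (Fin; zero; suc; _≟_)
open import Data.Product using (Σ; ∃; _×_; _,_)
open import Data.Sum using (_⊎_)
open import Data.Empty using (⊥)
open import Relation.Nullary using (yes; no)
open import Relation.Binary.PropositionalEquality using (_≡_)

-- Combinatorics of extended quivers.
-- b i j  = number of arrows x_i → x_j of the underlying quiver.
-- c l i j = number of 2-paths (ξ_i → x_l → ξ_j).

InI : ∀ {n m} → (Fin n → Fin m → Fin m → ℕ) → Fin n → Fin m → Set
InI c k i = ∃ λ j → 0 < c k i j

InJ : ∀ {n m} → (Fin n → Fin m → Fin m → ℕ) → Fin n → Fin m → Set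
InJ c k j = ∃ λ i → 0 < c k i j

record IsExtendedQuiver {n m : ℕ} (b : Fin n → Fin n → ℕ)
                        (c : Fin n → Fin m → Fin m → ℕ) : Set where
  field
    no-loops     : ∀ i → b i i ≡ 0
    no-2-cycles  : ∀ i j → b i j ≡ 0 ⊎ b j i ≡ 0
    disjoint     : ∀ k a → InI c k a → InJ c k a → ⊥
    uniform      : ∀ k → ∃ λ N → ∀ i j → InI c k i → InJ c k j → c k i j ≡ N

μQ : ∀ {n} → Fin n → (Fin n → Fin n → ℕ) → Fin n → Fin n → ℕ
μQ k b i j with i ≟ k | j ≟ k
... | yes _ | _     = b j i
... | no _  | yes _ = b j i
... | no _  | no _  = (b i j +ℕ b i k *ℕ b k j) ∸ (b j i +ℕ b j k *ℕ b k i)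

μc-raw : ∀ {n m} → Fin n → (Fin n → Fin n → ℕ) → (Fin n → Fin m → Fin m → ℕ)
         → Fin n → Fin m → Fin m → ℕ
μc-raw k b c l i j with l ≟ k
... | yes _ = c k j i
... | no _  = c l i j +ℕ c k i j *ℕ b k l

μc : ∀ {n m} → Fin n → (Fin n → Fin n → ℕ) → (Fin n → Fin m → Fin m → ℕ)
     → Fin n → Fin m → Fin m → ℕ
μc k b c l i j = μc-raw k b c l i j ∸ μc-raw k b c l j i

replace : ∀ {a} {A : Set a} {n} → (Fin n → A) → Fin n → A → Fin n → A
replace f k v i with i ≟ k
... | yes _ = v
... | no _  = f i

-- Algebra of differential forms on a superspace: a supercommutative
-- (Z/2-graded by total parity) ring with an odd differential d, d² = 0,
-- obeying the graded Leibniz rule.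

record SuperDGA (c ℓ : Level) : Set (lsuc (c ⊔ ℓ)) where
  field
    ring : Ring c ℓ
  open Ring ring public
  field
    Even Odd   : Carrier → Set ℓ
    Even-resp  : ∀ {x y} → x ≈ y → Even x → Even y
    Odd-resp   : ∀ {x y} → x ≈ y → Odd x → Odd y
    even-0     : Even 0#
    even-1     : Even 1#
    odd-0      : Odd 0#
    even-+     : ∀ {x y} → Even x → Even y → Even (x + y)
    odd-+      : ∀ {x y} → Odd x → Odd y → Odd (x + y)
    even-neg   : ∀ {x} → Even x → Even (- x)
    odd-neg    : ∀ {x} → Odd x → Odd (- x)
    even-*     : ∀ {x y} → Even x → Even y → Even (x * y)
    odd-*odd   : ∀ {x y} → Odd x → Odd y → Even (x * y)
    even-*odd  : ∀ {x y} → Even x → Odd y → Odd (x * y)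
    odd-*even  : ∀ {x y} → Odd x → Even y → Odd (x * y)
    even-comm  : ∀ {x} y → Even x → x * y ≈ y * x
    odd-anti   : ∀ {x y} → Odd x → Odd y → x * y ≈ - (y * x)
    odd-sq     : ∀ {x} → Odd x → x * x ≈ 0#
    d          : Carrier → Carrier
    d-cong     : ∀ {x y} → x ≈ y → d x ≈ d y
    d-+        : ∀ x y → d (x + y) ≈ d x + d y
    d-d        : ∀ x → d (d x) ≈ 0#
    d-even     : ∀ {x} → Even x → Odd (d x)
    d-odd      : ∀ {x} → Odd x → Even (d x)
    leibniz-even : ∀ {x} y → Even x → d (x * y) ≈ d x * y + x * d y
    leibniz-odd  : ∀ {x} y → Odd x → d (x * y) ≈ d x * y + - (x * d y)

module Forms {c ℓ : Level} (S : SuperDGA c ℓ) where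
  open SuperDGA S using (Carrier; _+_; _*_; 0#; 1#; d)

  ∑ : ∀ {k} → (Fin k → Carrier) → Carrier
  ∑ {zero}  f = 0#
  ∑ {suc k} f = f zero + ∑ (λ i → f (suc i))

  ∏ : ∀ {k} → (Fin k → Carrier) → Carrier
  ∏ {zero}  f = 1#
  ∏ {suc k} f = f zero * ∏ (λ i → f (suc i))

  _^′_ : Carrier → ℕ → Carrier
  x ^′ zero  = 1#
  x ^′ suc k = x * (x ^′ k)

  times : ℕ → Carrier → Carrier
  times zero    x = 0#
  times (suc k) x = x + times k x

  ω : ∀ {n m} → (Fin n → Fin n → ℕ) → (Fin n → Fin m → Fin m → ℕ)
      → (x xinv : Fin n → Carrier) → (ξ : Fin m → Carrier) → Carrier
  ω b c x xinv ξ =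
      ∑ (λ i → ∑ (λ j → times (b i j) (d (x i) * d (x j) * (xinv i * xinv j))))
    + ∑ (λ l → ∑ (λ i → ∑ (λ j →
        times (c l i j) (d (ξ i * ξ j) * d (x l) * xinv l))))

  exchange : ∀ {n m} → Fin n → (Fin n → Fin n → ℕ) → (Fin n → Fin m → Fin m → ℕ)
             → (x : Fin n → Carrier) → (ξ : Fin m → Carrier) → Carrier
  exchange k b c x ξ =
      ∏ (λ j → x j ^′ b k j)
    + (1# + ∑ (λ i → ∑ (λ j → times (c k i j) (ξ i * ξ j)))) * ∏ (λ i → x i ^′ b i k)

module Submission where

-- With the odd 1-forms D i = dx_i/x_i and θ i j = d(ξ_i ξ_j),
--   ω = ∑ b_ij D_i D_j + ∑ c_lij θ_ij D_l = R + D_k α,   α = a - p - Θ′,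
-- where R collects the terms not involving k, a (resp. p) sums D_j over
-- the arrows leaving (resp. entering) k, and Θ′ sums θ_ij over the
-- 2-paths through k.  The proof combines three facts:
--  * d of the exchange relation, multiplied by α, gives (D_k + D′_k) α = -a β
--    with β = p + Θ′ (using Θ dΘ = 0 for the 2-path sum Θ, which factors
--    into two odd elements by uniformity);
--  * after mutation the coefficient of D′_k is -α;
--  * R - a β is the part of the mutated form away from k: -a β adds the
--    composite arrows and completed 2-paths, and the cancellations are
--    invisible in sums against antisymmetric terms.

open import Defs
open import Level using (Level)
open import Data.Nat using (ℕ; zero; suc; _<_)
  renaming (_+_ to _+ℕ_; _*_ to _*ℕ_; _∸_ to _∸ℕ_)
open import Data.Nat.Properties using (_<?_; *-zeroʳ; *-comm; 0∸n≡0; n≤0⇒n≡0; ≮⇒≥)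
open import Data.Fin using (Fin; zero; suc; _≟_)
open import Data.Fin.Properties using (suc-injective; any?)
open import Data.Product using (∃; _×_; _,_)
open import Data.Empty using (⊥-elim)
open import Function using (_∘_)
open import Relation.Nullary using (yes; no; ¬_; Dec)
open import Relation.Binary.PropositionalEquality as P using (_≡_; _≢_)

μQ-from-k : ∀ {r} (k : Fin r) b j → μQ k b k j ≡ b j k
μQ-from-k k b j with k ≟ k | j ≟ k
... | yes _ | _ = P.refl
... | no k≢k | _ = ⊥-elim (k≢k P.refl)

μQ-to-k : ∀ {r} (k : Fin r) b i → μQ k b i k ≡ b k i
μQ-to-k k b i with i ≟ k | k ≟ k
... | yes _ | _ = P.refl
... | no _ | yes _ = P.refl
... | no _ | no k≢k = ⊥-elim (k≢k P.refl)

μQ-away : ∀ {r} (k : Fin r) b {i j} → i ≢ k → j ≢ k →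
          μQ k b i j ≡ (b i j +ℕ b i k *ℕ b k j) ∸ℕ (b j i +ℕ b j k *ℕ b k i)
μQ-away k b {i} {j} i≢k j≢k with i ≟ k | j ≟ k
... | yes i≡k | _ = ⊥-elim (i≢k i≡k)
... | no _ | yes j≡k = ⊥-elim (j≢k j≡k)
... | no _ | no _ = P.refl

μc-raw-at-k : ∀ {r s} (k : Fin r) b (c : Fin r → Fin s → Fin s → ℕ) i j →
              μc-raw k b c k i j ≡ c k j i
μc-raw-at-k k b c i j with k ≟ k
... | yes _ = P.refl
... | no k≢k = ⊥-elim (k≢k P.refl)

μc-raw-away : ∀ {r s} (k : Fin r) b (c : Fin r → Fin s → Fin s → ℕ) {l} i j → l ≢ k →
              μc-raw k b c l i j ≡ c l i j +ℕ c k i j *ℕ b k l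
μc-raw-away k b c {l} i j l≢k with l ≟ k
... | yes l≡k = ⊥-elim (l≢k l≡k)
... | no _ = P.refl

μc-at-k : ∀ {r s} (k : Fin r) b (c : Fin r → Fin s → Fin s → ℕ) i j →
          μc k b c k i j ≡ c k j i ∸ℕ c k i j
μc-at-k k b c i j = P.cong₂ _∸ℕ_ (μc-raw-at-k k b c i j) (μc-raw-at-k k b c j i)

μc-away : ∀ {r s} (k : Fin r) b (c : Fin r → Fin s → Fin s → ℕ) {l} i j → l ≢ k →
          μc k b c l i j ≡ (c l i j +ℕ c k i j *ℕ b k l) ∸ℕ (c l j i +ℕ c k j i *ℕ b k l)
μc-away k b c i j l≢k = P.cong₂ _∸ℕ_ (μc-raw-away k b c i j l≢k) (μc-raw-away k b c j i l≢k)

replace-at : ∀ {a} {A : Set a} {r} (f : Fin r → A) k v → replace f k v k ≡ v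
replace-at f k v with k ≟ k
... | yes _ = P.refl
... | no k≢k = ⊥-elim (k≢k P.refl)

replace-away : ∀ {a} {A : Set a} {r} (f : Fin r → A) k v {i} → i ≢ k → replace f k v i ≡ f i
replace-away f k v {i} i≢k with i ≟ k
... | yes i≡k = ⊥-elim (i≢k i≡k)
... | no _ = P.refl

replace-preserves : ∀ {a p} {A : Set a} (Pr : A → Set p) {r} (f : Fin r → A) k v →
                    Pr v → (∀ i → Pr (f i)) → ∀ i → Pr (replace f k v i)
replace-preserves Pr f k v pv pf i with i ≟ k
... | yes _ = pv
... | no _ = pf i

away : ∀ {r} → Fin r → (Fin r → Fin r → ℕ) → Fin r → Fin r → ℕ
away k M i j with i ≟ k | j ≟ k
... | no _ | no _ = M i j
... | _ | _ = 0

away-row : ∀ {r} (k : Fin r) M j → away k M k j ≡ 0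
away-row k M j with k ≟ k | j ≟ k
... | yes _ | _ = P.refl
... | no k≢k | _ = ⊥-elim (k≢k P.refl)

away-col : ∀ {r} (k : Fin r) M i → away k M i k ≡ 0
away-col k M i with i ≟ k | k ≟ k
... | yes _ | _ = P.refl
... | no _ | yes _ = P.refl
... | no _ | no k≢k = ⊥-elim (k≢k P.refl)

away-entry : ∀ {r} (k : Fin r) M {i j} → i ≢ k → j ≢ k → away k M i j ≡ M i j
away-entry k M {i} {j} i≢k j≢k with i ≟ k | j ≟ k
... | yes i≡k | _ = ⊥-elim (i≢k i≡k)
... | no _ | yes j≡k = ⊥-elim (j≢k j≡k)
... | no _ | no _ = P.refl

away₃ : ∀ {r s} → Fin r → (Fin r → Fin s → Fin s → ℕ) → Fin r → Fin s → Fin s → ℕ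
away₃ k N l i j with l ≟ k
... | yes _ = 0
... | no _ = N l i j

away₃-at : ∀ {r s} (k : Fin r) (N : Fin r → Fin s → Fin s → ℕ) i j → away₃ k N k i j ≡ 0
away₃-at k N i j with k ≟ k
... | yes _ = P.refl
... | no k≢k = ⊥-elim (k≢k P.refl)

away₃-entry : ∀ {r s} (k : Fin r) (N : Fin r → Fin s → Fin s → ℕ) {l} i j → l ≢ k →
              away₃ k N l i j ≡ N l i j
away₃-entry k N {l} i j l≢k with l ≟ k
... | yes l≡k = ⊥-elim (l≢k l≡k)
... | no _ = P.refl

composed : ∀ {r} → Fin r → (Fin r → Fin r → ℕ) → Fin r → Fin r → ℕ
composed k b i j = away k b i j +ℕ b i k *ℕ b k j

away-μQ : ∀ {r} (k : Fin r) b → b k k ≡ 0 → ∀ i j →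
          away k (μQ k b) i j ≡ composed k b i j ∸ℕ composed k b j i
away-μQ k b b-kk i j = by-cases (i ≟ k) (j ≟ k)
  where
  by-cases : Dec (i ≡ k) → Dec (j ≡ k) → away k (μQ k b) i j ≡ composed k b i j ∸ℕ composed k b j i
  by-cases (yes P.refl) _
    rewrite away-row k (μQ k b) j | away-row k b j | b-kk = P.sym (0∸n≡0 (away k b j k +ℕ b j k *ℕ 0))
  by-cases (no _) (yes P.refl)
    rewrite away-col k (μQ k b) i | away-col k b i | b-kk | *-zeroʳ (b i k) = P.sym (0∸n≡0 (away k b k i +ℕ 0))
  by-cases (no i≢k) (no j≢k)
    rewrite away-entry k (μQ k b) i≢k j≢k | μQ-away k b i≢k j≢k
          | away-entry k b i≢k j≢k | away-entry k b j≢k i≢k = P.refl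

completed : ∀ {r s} → Fin r → (Fin r → Fin r → ℕ) → (Fin r → Fin s → Fin s → ℕ) →
            Fin r → Fin s → Fin s → ℕ
completed k b c l i j = away₃ k c l i j +ℕ c k i j *ℕ b k l

away₃-μc : ∀ {r s} (k : Fin r) b (c : Fin r → Fin s → Fin s → ℕ) → b k k ≡ 0 → ∀ l i j →
           away₃ k (μc k b c) l i j ≡ completed k b c l i j ∸ℕ completed k b c l j i
away₃-μc k b c b-kk l i j = by-cases (l ≟ k)
  where
  by-cases : Dec (l ≡ k) → away₃ k (μc k b c) l i j ≡ completed k b c l i j ∸ℕ completed k b c l j i
  by-cases (yes P.refl)
    rewrite away₃-at k (μc k b c) i j | away₃-at k c i j | away₃-at k c j i
          | b-kk | *-zeroʳ (c k i j) | *-zeroʳ (c k j i) = P.refl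
  by-cases (no l≢k)
    rewrite away₃-entry k (μc k b c) i j l≢k | μc-away k b c i j l≢k
          | away₃-entry k c i j l≢k | away₃-entry k c j i l≢k = P.refl

module Invariance {c ℓ : Level} (S : SuperDGA c ℓ) where
  open SuperDGA S hiding (zero)
  open Forms S
  open import Algebra.Properties.Ring ring
    using (-‿distribˡ-*; -‿distribʳ-*; -‿anti-homo-+; -0#≈0#; -‿involutive;
           x+x≈x⇒x≈0; x[y-z]≈xy-xz; +-inverseʳ-unique)
  open import Algebra.Properties.CommutativeSemigroup +-commutativeSemigroup
    using (interchange)
  open import Relation.Binary.Reasoning.Setoid setoid

  -‿distrib-+ : ∀ x y → - (x + y) ≈ - x + - y
  -‿distrib-+ x y = trans (-‿anti-homo-+ x y) (+-comm (- y) (- x))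

  x+y≈z⇒x≈z-y : ∀ {x y z} → x + y ≈ z → x ≈ z - y
  x+y≈z⇒x≈z-y {x} {y} {z} x+y≈z = begin
    x              ≈⟨ +-identityʳ x ⟨
    x + 0#         ≈⟨ +-cong refl (-‿inverseʳ y) ⟨
    x + (y - y)    ≈⟨ +-assoc x y (- y) ⟨
    (x + y) - y    ≈⟨ +-cong x+y≈z refl ⟩
    z - y          ∎

  ∑-cong : ∀ {r} {f g : Fin r → Carrier} → (∀ i → f i ≈ g i) → ∑ f ≈ ∑ g
  ∑-cong {zero} f≈g = refl
  ∑-cong {suc r} f≈g = +-cong (f≈g zero) (∑-cong (f≈g ∘ suc))

  ∑-0 : ∀ {r} → ∑ {r} (λ _ → 0#) ≈ 0#
  ∑-0 {zero} = refl
  ∑-0 {suc r} = trans (+-identityˡ _) (∑-0 {r})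

  ∑-+ : ∀ {r} (f g : Fin r → Carrier) → ∑ (λ i → f i + g i) ≈ ∑ f + ∑ g
  ∑-+ {zero} f g = sym (+-identityˡ 0#)
  ∑-+ {suc r} f g = trans (+-cong refl (∑-+ (f ∘ suc) (g ∘ suc))) (interchange _ _ _ _)

  ∑-*ˡ : ∀ {r} a (f : Fin r → Carrier) → ∑ (λ i → a * f i) ≈ a * ∑ f
  ∑-*ˡ {zero} a f = sym (zeroʳ a)
  ∑-*ˡ {suc r} a f = trans (+-cong refl (∑-*ˡ a (f ∘ suc))) (sym (distribˡ a _ _))

  ∑-*ʳ : ∀ {r} a (f : Fin r → Carrier) → ∑ (λ i → f i * a) ≈ ∑ f * a
  ∑-*ʳ {zero} a f = sym (zeroˡ a)
  ∑-*ʳ {suc r} a f = trans (+-cong refl (∑-*ʳ a (f ∘ suc))) (sym (distribʳ a _ _))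

  ∑-neg : ∀ {r} (f : Fin r → Carrier) → ∑ (λ i → - f i) ≈ - ∑ f
  ∑-neg {zero} f = sym -0#≈0#
  ∑-neg {suc r} f = trans (+-cong refl (∑-neg (f ∘ suc))) (sym (-‿distrib-+ _ _))

  ∑-swap : ∀ {r s} (f : Fin r → Fin s → Carrier) →
           ∑ (λ i → ∑ (λ j → f i j)) ≈ ∑ (λ j → ∑ (λ i → f i j))
  ∑-swap {zero} {s} f = sym (∑-0 {s})
  ∑-swap {suc r} {s} f = trans (+-cong refl (∑-swap (f ∘ suc))) (sym (∑-+ {s} _ _))

  ∑-product : ∀ {r s} (f : Fin r → Carrier) (g : Fin s → Carrier) →
              ∑ f * ∑ g ≈ ∑ (λ i → ∑ (λ j → f i * g j))
  ∑-product f g = trans (sym (∑-*ʳ _ f)) (∑-cong (λ i → sym (∑-*ˡ (f i) g)))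

  ∑∑-neg : ∀ {r s} (f : Fin r → Fin s → Carrier) →
           - ∑ (λ i → ∑ (f i)) ≈ ∑ (λ i → ∑ (λ j → - f i j))
  ∑∑-neg f = sym (trans (∑-cong λ i → ∑-neg (f i)) (∑-neg (λ i → ∑ (f i))))

  ∑-extract : ∀ {r} (k : Fin r) {f g : Fin r → Carrier} →
              (∀ i → i ≢ k → f i ≈ g i) → g k ≈ 0# → ∑ f ≈ ∑ g + f k
  ∑-extract zero {f} {g} f≈g gk≈0 = begin
    f zero + ∑ (f ∘ suc)          ≈⟨ +-comm _ _ ⟩
    ∑ (f ∘ suc) + f zero          ≈⟨ +-cong (∑-cong (λ i → f≈g (suc i) (λ ()))) refl ⟩
    ∑ (g ∘ suc) + f zero          ≈⟨ +-cong (+-identityˡ _) refl ⟨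
    (0# + ∑ (g ∘ suc)) + f zero   ≈⟨ +-cong (+-cong (sym gk≈0) refl) refl ⟩
    (g zero + ∑ (g ∘ suc)) + f zero ∎
  ∑-extract (suc k) {f} {g} f≈g gk≈0 = begin
    f zero + ∑ (f ∘ suc)                    ≈⟨ +-cong (f≈g zero (λ ())) IH ⟩
    g zero + (∑ (g ∘ suc) + f (suc k))      ≈⟨ +-assoc _ _ _ ⟨
    (g zero + ∑ (g ∘ suc)) + f (suc k)      ∎
    where
    IH : ∑ (f ∘ suc) ≈ ∑ (g ∘ suc) + f (suc k)
    IH = ∑-extract k (λ i i≢k → f≈g (suc i) (i≢k ∘ suc-injective)) gk≈0

  ∑∑-by-pairs : ∀ {r} (h h′ : Fin r → Fin r → Carrier) →
                (∀ i j → h i j + h j i ≈ h′ i j + h′ j i) → (∀ i → h i i ≈ h′ i i) →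
                ∑ (λ i → ∑ (λ j → h i j)) ≈ ∑ (λ i → ∑ (λ j → h′ i j))
  ∑∑-by-pairs {zero} h h′ _ _ = refl
  ∑∑-by-pairs {suc r} h h′ pairs diag = begin
    (h zero zero + ∑ (row h)) + ∑ (λ i → col h i + ∑ (inner h i))
      ≈⟨ +-cong refl (∑-+ (col h) (λ i → ∑ (inner h i))) ⟩
    (h zero zero + ∑ (row h)) + (∑ (col h) + corner h)
      ≈⟨ regroup _ _ _ _ ⟩
    h zero zero + ((∑ (row h) + ∑ (col h)) + corner h)
      ≈⟨ +-cong (diag zero) (+-cong cross IH) ⟩
    h′ zero zero + ((∑ (row h′) + ∑ (col h′)) + corner h′)
      ≈⟨ regroup _ _ _ _ ⟨
    (h′ zero zero + ∑ (row h′)) + (∑ (col h′) + corner h′)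
      ≈⟨ +-cong refl (∑-+ (col h′) (λ i → ∑ (inner h′ i))) ⟨
    (h′ zero zero + ∑ (row h′)) + ∑ (λ i → col h′ i + ∑ (inner h′ i)) ∎
    where
    row col : (Fin (suc r) → Fin (suc r) → Carrier) → Fin r → Carrier
    row g j = g zero (suc j)
    col g i = g (suc i) zero
    inner : (Fin (suc r) → Fin (suc r) → Carrier) → Fin r → Fin r → Carrier
    inner g i j = g (suc i) (suc j)
    corner : (Fin (suc r) → Fin (suc r) → Carrier) → Carrier
    corner g = ∑ (λ i → ∑ (inner g i))
    regroup : ∀ a b c e → (a + b) + (c + e) ≈ a + ((b + c) + e)
    regroup a b c e = trans (+-assoc a b (c + e)) (+-cong refl (sym (+-assoc b c e)))
    cross : ∑ (row h) + ∑ (col h) ≈ ∑ (row h′) + ∑ (col h′)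
    cross = trans (sym (∑-+ (row h) (col h)))
              (trans (∑-cong (λ j → pairs zero (suc j))) (∑-+ (row h′) (col h′)))
    IH : corner h ≈ corner h′
    IH = ∑∑-by-pairs (inner h) (inner h′) (λ i j → pairs (suc i) (suc j)) (diag ∘ suc)

  times-cong : ∀ p {x y} → x ≈ y → times p x ≈ times p y
  times-cong zero x≈y = refl
  times-cong (suc p) x≈y = +-cong x≈y (times-cong p x≈y)

  times-≡ : ∀ {p q} x → p ≡ q → times p x ≈ times q x
  times-≡ x P.refl = refl

  times-0 : ∀ p → times p 0# ≈ 0#
  times-0 zero = refl
  times-0 (suc p) = trans (+-identityˡ _) (times-0 p)

  times-+ : ∀ p q x → times (p +ℕ q) x ≈ times p x + times q x
  times-+ zero q x = sym (+-identityˡ _)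
  times-+ (suc p) q x = trans (+-cong refl (times-+ p q x)) (sym (+-assoc _ _ _))

  times-*ˡ : ∀ p a x → a * times p x ≈ times p (a * x)
  times-*ˡ zero a x = zeroʳ a
  times-*ˡ (suc p) a x = trans (distribˡ a x _) (+-cong refl (times-*ˡ p a x))

  times-*ʳ : ∀ p x a → times p x * a ≈ times p (x * a)
  times-*ʳ zero x a = zeroˡ a
  times-*ʳ (suc p) x a = trans (distribʳ a x _) (+-cong refl (times-*ʳ p x a))

  times-neg : ∀ p x → times p (- x) ≈ - times p x
  times-neg zero x = sym -0#≈0#
  times-neg (suc p) x = trans (+-cong refl (times-neg p x)) (sym (-‿distrib-+ _ _))

  times-* : ∀ p q x → times (p *ℕ q) x ≈ times p (times q x)
  times-* zero q x = refl
  times-* (suc p) q x = trans (times-+ q (p *ℕ q) x) (+-cong refl (times-* p q x))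

  times-product : ∀ p q x y → times p x * times q y ≈ times (q *ℕ p) (x * y)
  times-product p q x y = begin
    times p x * times q y       ≈⟨ times-*ʳ p x _ ⟩
    times p (x * times q y)     ≈⟨ times-cong p (times-*ˡ q x y) ⟩
    times p (times q (x * y))   ≈⟨ times-* p q _ ⟨
    times (p *ℕ q) (x * y)      ≈⟨ times-≡ _ (*-comm p q) ⟩
    times (q *ℕ p) (x * y)      ∎

  anticommute-times : ∀ p q {x y} → Odd x → Odd y →
                      - (times p x * times q y) ≈ times (q *ℕ p) (y * x)
  anticommute-times p q {x} {y} odd-x odd-y = begin
    - (times p x * times q y)       ≈⟨ -‿cong (times-product p q x y) ⟩
    - times (q *ℕ p) (x * y)        ≈⟨ times-neg (q *ℕ p) (x * y) ⟨
    times (q *ℕ p) (- (x * y))      ≈⟨ times-cong (q *ℕ p) (odd-anti odd-y odd-x) ⟨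
    times (q *ℕ p) (y * x)          ∎

  times-∸-cancel : ∀ A B {X Y} → Y ≈ - X →
                   times (A ∸ℕ B) X + times (B ∸ℕ A) Y ≈ times A X + times B Y
  times-∸-cancel zero zero Y≈-X = refl
  times-∸-cancel zero (suc B) Y≈-X = refl
  times-∸-cancel (suc A) zero Y≈-X = refl
  times-∸-cancel (suc A) (suc B) {X} {Y} Y≈-X = begin
    times (A ∸ℕ B) X + times (B ∸ℕ A) Y   ≈⟨ times-∸-cancel A B Y≈-X ⟩
    times A X + times B Y                 ≈⟨ +-identityˡ _ ⟨
    0# + (times A X + times B Y)          ≈⟨ +-cong X+Y≈0 refl ⟨
    (X + Y) + (times A X + times B Y)     ≈⟨ interchange _ _ _ _ ⟩
    times (suc A) X + times (suc B) Y     ∎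
    where
    X+Y≈0 : X + Y ≈ 0#
    X+Y≈0 = trans (+-cong refl Y≈-X) (-‿inverseʳ X)

  -- Step (3*) and the cancellation of 2-cycles in (0): against an
  -- antisymmetric X with zero diagonal, replacing the multiplicities
  -- A i j by A i j ∸ A j i does not change the double sum.
  ∑∑-cancel : ∀ {r} (A : Fin r → Fin r → ℕ) (X : Fin r → Fin r → Carrier) →
              (∀ i j → X j i ≈ - X i j) → (∀ i → X i i ≈ 0#) →
              ∑ (λ i → ∑ (λ j → times (A i j ∸ℕ A j i) (X i j))) ≈
              ∑ (λ i → ∑ (λ j → times (A i j) (X i j)))
  ∑∑-cancel A X anti diag =
    ∑∑-by-pairs (λ i j → times (A i j ∸ℕ A j i) (X i j)) (λ i j → times (A i j) (X i j))
      (λ i j → times-∸-cancel (A i j) (A j i) (anti i j))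
      (λ i → trans (vanishes (A i i ∸ℕ A i i) i) (sym (vanishes (A i i) i)))
    where
    vanishes : ∀ p i → times p (X i i) ≈ 0#
    vanishes p i = trans (times-cong p (diag i)) (times-0 p)

  ∑-anticommute : ∀ {r} (f : Fin r → ℕ) (g : Fin r → Carrier) {e} → Odd e → (∀ i → Odd (g i)) →
                  ∑ (λ i → times (f i) (g i * e)) ≈ - (e * ∑ (λ i → times (f i) (g i)))
  ∑-anticommute f g {e} odd-e odd-g = begin
    ∑ (λ i → times (f i) (g i * e))        ≈⟨ ∑-cong (λ i → times-cong (f i) (odd-anti (odd-g i) odd-e)) ⟩
    ∑ (λ i → times (f i) (- (e * g i)))    ≈⟨ ∑-cong (λ i → times-neg (f i) (e * g i)) ⟩
    ∑ (λ i → - times (f i) (e * g i))      ≈⟨ ∑-neg (λ i → times (f i) (e * g i)) ⟩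
    - ∑ (λ i → times (f i) (e * g i))      ≈⟨ -‿cong (∑-cong λ i → times-*ˡ (f i) e (g i)) ⟨
    - ∑ (λ i → e * times (f i) (g i))      ≈⟨ -‿cong (∑-*ˡ e (λ i → times (f i) (g i))) ⟩
    - (e * ∑ (λ i → times (f i) (g i)))    ∎

  d-0 : d 0# ≈ 0#
  d-0 = x+x≈x⇒x≈0 (d 0#) (trans (sym (d-+ 0# 0#)) (d-cong (+-identityʳ 0#)))

  d-1 : d 1# ≈ 0#
  d-1 = x+x≈x⇒x≈0 (d 1#) (begin
    d 1# + d 1#              ≈⟨ +-cong (*-identityʳ _) (*-identityˡ _) ⟨
    d 1# * 1# + 1# * d 1#    ≈⟨ leibniz-even 1# even-1 ⟨
    d (1# * 1#)              ≈⟨ d-cong (*-identityˡ 1#) ⟩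
    d 1#                     ∎)

  d-neg : ∀ x → d (- x) ≈ - d x
  d-neg x = +-inverseʳ-unique (d x) (d (- x))
    (trans (sym (d-+ x (- x))) (trans (d-cong (-‿inverseʳ x)) d-0))

  d-times : ∀ p x → d (times p x) ≈ times p (d x)
  d-times zero x = d-0
  d-times (suc p) x = trans (d-+ _ _) (+-cong refl (d-times p x))

  d-∑ : ∀ {r} (f : Fin r → Carrier) → d (∑ f) ≈ ∑ (λ i → d (f i))
  d-∑ {zero} f = d-0
  d-∑ {suc r} f = trans (d-+ _ _) (+-cong refl (d-∑ (f ∘ suc)))

  odd-times : ∀ p {x} → Odd x → Odd (times p x)
  odd-times zero ox = odd-0
  odd-times (suc p) ox = odd-+ ox (odd-times p ox)

  even-times : ∀ p {x} → Even x → Even (times p x)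
  even-times zero ex = even-0
  even-times (suc p) ex = even-+ ex (even-times p ex)

  odd-∑ : ∀ {r} {f : Fin r → Carrier} → (∀ i → Odd (f i)) → Odd (∑ f)
  odd-∑ {zero} of = odd-0
  odd-∑ {suc r} of = odd-+ (of zero) (odd-∑ (of ∘ suc))

  even-∑ : ∀ {r} {f : Fin r → Carrier} → (∀ i → Even (f i)) → Even (∑ f)
  even-∑ {zero} ef = even-0
  even-∑ {suc r} ef = even-+ (ef zero) (even-∑ (ef ∘ suc))

  even-∏ : ∀ {r} {f : Fin r → Carrier} → (∀ i → Even (f i)) → Even (∏ f)
  even-∏ {zero} ef = even-1
  even-∏ {suc r} ef = even-* (ef zero) (even-∏ (ef ∘ suc))

  even-^ : ∀ {y} → Even y → ∀ e → Even (y ^′ e)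
  even-^ ey zero = even-1
  even-^ ey (suc e) = even-* ey (even-^ ey e)

  -- Uniformity of the 2-paths through a vertex makes their sum factor:
  -- ∑ c i j ξ_i ξ_j = (N ∑_{i ∈ I} ξ_i)(∑_{j ∈ J} ξ_j), a product of two
  -- odd elements.
  two-path-sum-factors : ∀ {m} (c : Fin m → Fin m → ℕ) (ξ : Fin m → Carrier) →
    (∀ a → Odd (ξ a)) →
    (∃ λ N → ∀ i j → (∃ λ j′ → 0 < c i j′) → (∃ λ i′ → 0 < c i′ j) → c i j ≡ N) →
    ∃ λ u → ∃ λ v → Odd u × Odd v × ∑ (λ i → ∑ (λ j → times (c i j) (ξ i * ξ j))) ≈ u * v
  two-path-sum-factors {m} c ξ odd-ξ (N , uniform) = u , v , odd-u , odd-v , factor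
    where
    starts : ∀ i → Dec (∃ λ j → 0 < c i j)
    starts i = any? (λ j → 0 <? c i j)
    ends : ∀ j → Dec (∃ λ i → 0 < c i j)
    ends j = any? (λ i → 0 <? c i j)
    select : ∀ {A : Set} → Dec A → Carrier → Carrier
    select (yes _) y = y
    select (no _) _ = 0#
    odd-select : ∀ {A : Set} (a? : Dec A) {y} → Odd y → Odd (select a? y)
    odd-select (yes _) odd-y = odd-y
    odd-select (no _) _ = odd-0
    uᵢ vⱼ : Fin m → Carrier
    uᵢ i = times N (select (starts i) (ξ i))
    vⱼ j = select (ends j) (ξ j)
    u v : Carrier
    u = ∑ uᵢ
    v = ∑ vⱼ
    odd-u : Odd u
    odd-u = odd-∑ λ i → odd-times N (odd-select (starts i) (odd-ξ i))
    odd-v : Odd v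
    odd-v = odd-∑ λ j → odd-select (ends j) (odd-ξ j)
    no-path : ∀ {i j} → ¬ (0 < c i j) → c i j ≡ 0
    no-path ¬0<c = n≤0⇒n≡0 (≮⇒≥ ¬0<c)
    term : ∀ i j → times (c i j) (ξ i * ξ j) ≈ uᵢ i * vⱼ j
    term i j with starts i | ends j
    ... | yes i∈I | yes j∈J rewrite uniform i j i∈I j∈J = sym (times-*ʳ N (ξ i) (ξ j))
    ... | no i∉I | _ rewrite no-path (λ 0<c → i∉I (j , 0<c)) =
      sym (trans (*-cong (times-0 N) refl) (zeroˡ _))
    ... | yes _ | no j∉J rewrite no-path (λ 0<c → j∉J (i , 0<c)) = sym (zeroʳ _)
    factor : ∑ (λ i → ∑ (λ j → times (c i j) (ξ i * ξ j))) ≈ u * v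
    factor = trans (∑-cong λ i → ∑-cong λ j → term i j) (sym (∑-product uᵢ vⱼ))

  dlog : Carrier → Carrier → Carrier
  dlog y yinv = d y * yinv

  d-^ : ∀ {y yinv} → Even y → y * yinv ≈ 1# →
        ∀ e → d (y ^′ e) ≈ y ^′ e * times e (dlog y yinv)
  d-^ ey inv zero = trans d-1 (sym (zeroʳ 1#))
  d-^ {y} {yinv} ey inv (suc e) = begin
    d (y * yᵉ)                          ≈⟨ leibniz-even yᵉ ey ⟩
    d y * yᵉ + y * d yᵉ                 ≈⟨ +-cong dy·yᵉ (*-cong refl (d-^ ey inv e)) ⟩
    (y * yᵉ) * E + y * (yᵉ * times e E) ≈⟨ +-cong refl (*-assoc _ _ _) ⟨
    (y * yᵉ) * E + (y * yᵉ) * times e E ≈⟨ distribˡ _ _ _ ⟨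
    (y * yᵉ) * times (suc e) E          ∎
    where
    yᵉ E : Carrier
    yᵉ = y ^′ e
    E = dlog y yinv
    dy≈y·E : d y ≈ y * E
    dy≈y·E = begin
      d y                 ≈⟨ *-identityʳ _ ⟨
      d y * 1#            ≈⟨ *-cong refl inv ⟨
      d y * (y * yinv)    ≈⟨ *-assoc _ _ _ ⟨
      (d y * y) * yinv    ≈⟨ *-cong (even-comm (d y) ey) refl ⟨
      (y * d y) * yinv    ≈⟨ *-assoc _ _ _ ⟩
      y * E               ∎
    dy·yᵉ : d y * yᵉ ≈ (y * yᵉ) * E
    dy·yᵉ = begin
      d y * yᵉ          ≈⟨ even-comm (d y) (even-^ ey e) ⟨
      yᵉ * d y          ≈⟨ *-cong refl dy≈y·E ⟩
      yᵉ * (y * E)      ≈⟨ *-assoc _ _ _ ⟨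
      (yᵉ * y) * E      ≈⟨ *-cong (even-comm y (even-^ ey e)) refl ⟩
      (y * yᵉ) * E      ∎

  d-monomial : ∀ {r} (y yinv : Fin r → Carrier) (e : Fin r → ℕ) →
               (∀ i → Even (y i)) → (∀ i → y i * yinv i ≈ 1#) →
               d (∏ (λ j → y j ^′ e j)) ≈
               ∏ (λ j → y j ^′ e j) * ∑ (λ j → times (e j) (dlog (y j) (yinv j)))
  d-monomial {zero} y yinv e ey inv = trans d-1 (sym (zeroʳ 1#))
  d-monomial {suc r} y yinv e ey inv = begin
    d (y₀ * R)                       ≈⟨ leibniz-even R (even-^ (ey zero) (e zero)) ⟩
    d y₀ * R + y₀ * d R              ≈⟨ +-cong (*-cong (d-^ (ey zero) (inv zero) (e zero)) refl)
                                                (*-cong refl IH) ⟩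
    (y₀ * G₀) * R + y₀ * (R * G)     ≈⟨ +-cong (*-assoc _ _ _) refl ⟩
    y₀ * (G₀ * R) + y₀ * (R * G)     ≈⟨ +-cong (*-cong refl (even-comm G₀ even-R)) refl ⟨
    y₀ * (R * G₀) + y₀ * (R * G)     ≈⟨ distribˡ _ _ _ ⟨
    y₀ * (R * G₀ + R * G)            ≈⟨ *-cong refl (distribˡ _ _ _) ⟨
    y₀ * (R * (G₀ + G))              ≈⟨ *-assoc _ _ _ ⟨
    (y₀ * R) * (G₀ + G)              ∎
    where
    y₀ R G₀ G : Carrier
    y₀ = y zero ^′ e zero
    R = ∏ (λ j → y (suc j) ^′ e (suc j))
    G₀ = times (e zero) (dlog (y zero) (yinv zero))
    G = ∑ (λ j → times (e (suc j)) (dlog (y (suc j)) (yinv (suc j))))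
    even-R : Even R
    even-R = even-∏ (λ j → even-^ (ey (suc j)) (e (suc j)))
    IH : d R ≈ R * G
    IH = d-monomial (y ∘ suc) (yinv ∘ suc) (e ∘ suc) (ey ∘ suc) (inv ∘ suc)

  -- A product Θ = u v of two odd elements satisfies Θ · dΘ = 0,
  -- since dΘ = du·v - u·dv and v² = u² = 0.
  odd-product-dsquare : ∀ {u v} → Odd u → Odd v → (u * v) * d (u * v) ≈ 0#
  odd-product-dsquare {u} {v} ou ov = begin
    (u * v) * d (u * v)                              ≈⟨ *-cong refl (leibniz-odd v ou) ⟩
    (u * v) * (d u * v + - (u * d v))                ≈⟨ distribˡ _ _ _ ⟩
    (u * v) * (d u * v) + (u * v) * - (u * d v)      ≈⟨ +-cong du-term (sym (-‿distribʳ-* _ _)) ⟩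
    0# + - ((u * v) * (u * d v))                     ≈⟨ +-identityˡ _ ⟩
    - ((u * v) * (u * d v))                          ≈⟨ -‿cong dv-term ⟩
    - 0#                                             ≈⟨ -0#≈0# ⟩
    0#                                               ∎
    where
    du-term : (u * v) * (d u * v) ≈ 0#
    du-term = begin
      (u * v) * (d u * v)   ≈⟨ *-assoc u v _ ⟩
      u * (v * (d u * v))   ≈⟨ *-cong refl (*-assoc v (d u) v) ⟨
      u * ((v * d u) * v)   ≈⟨ *-cong refl (*-cong (even-comm v (d-odd ou)) refl) ⟨
      u * ((d u * v) * v)   ≈⟨ *-cong refl (*-assoc (d u) v v) ⟩
      u * (d u * (v * v))   ≈⟨ *-cong refl (*-cong refl (odd-sq ov)) ⟩
      u * (d u * 0#)        ≈⟨ *-cong refl (zeroʳ _) ⟩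
      u * 0#                ≈⟨ zeroʳ u ⟩
      0#                    ∎
    uvu≈0 : (u * v) * u ≈ 0#
    uvu≈0 = begin
      (u * v) * u      ≈⟨ *-assoc u v u ⟩
      u * (v * u)      ≈⟨ *-cong refl (odd-anti ov ou) ⟩
      u * - (u * v)    ≈⟨ -‿distribʳ-* _ _ ⟨
      - (u * (u * v))  ≈⟨ -‿cong (*-assoc u u v) ⟨
      - ((u * u) * v)  ≈⟨ -‿cong (*-cong (odd-sq ou) refl) ⟩
      - (0# * v)       ≈⟨ -‿cong (zeroˡ v) ⟩
      - 0#             ≈⟨ -0#≈0# ⟩
      0#               ∎
    dv-term : (u * v) * (u * d v) ≈ 0#
    dv-term = trans (sym (*-assoc _ u (d v))) (trans (*-cong uvu≈0 refl) (zeroˡ _))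

  module SplitAt {n m : ℕ} (ξ : Fin m → Carrier) (odd-ξ : ∀ a → Odd (ξ a)) (k : Fin n) where

    θ : Fin m → Fin m → Carrier
    θ i j = d (ξ i * ξ j)

    θ-odd : ∀ i j → Odd (θ i j)
    θ-odd i j = d-even (odd-*odd (odd-ξ i) (odd-ξ j))

    θ-anti : ∀ i j → θ j i ≈ - θ i j
    θ-anti i j = trans (d-cong (odd-anti (odd-ξ j) (odd-ξ i))) (d-neg _)

    θ-diag : ∀ i → θ i i ≈ 0#
    θ-diag i = trans (d-cong (odd-sq (odd-ξ i))) d-0

    Q : (Fin n → Fin n → ℕ) → (Fin n → Carrier) → Carrier
    Q M E = ∑ (λ i → ∑ (λ j → times (M i j) (E i * E j)))

    C : (Fin n → Fin m → Fin m → ℕ) → (Fin n → Carrier) → Carrier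
    C N E = ∑ (λ l → ∑ (λ i → ∑ (λ j → times (N l i j) (θ i j * E l))))

    -- ω regrouped: dx_i dx_j /(x_i x_j) = (dx_i/x_i)(dx_j/x_j) as x_i⁻¹ is even
    ω≈Q+C : ∀ M N (y yinv : Fin n → Carrier) → (∀ i → Even (yinv i)) →
            ω M N y yinv ξ ≈ Q M (λ i → dlog (y i) (yinv i)) + C N (λ i → dlog (y i) (yinv i))
    ω≈Q+C M N y yinv even-yinv =
      +-cong (∑-cong λ i → ∑-cong λ j → times-cong (M i j) (arrow i j))
             (∑-cong λ l → ∑-cong λ i → ∑-cong λ j → times-cong (N l i j) (*-assoc _ _ _))
      where
      arrow : ∀ i j → d (y i) * d (y j) * (yinv i * yinv j) ≈ dlog (y i) (yinv i) * dlog (y j) (yinv j)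
      arrow i j = begin
        (d (y i) * d (y j)) * (yinv i * yinv j)   ≈⟨ *-assoc _ _ _ ⟩
        d (y i) * (d (y j) * (yinv i * yinv j))   ≈⟨ *-cong refl (*-assoc _ _ _) ⟨
        d (y i) * ((d (y j) * yinv i) * yinv j)   ≈⟨ *-cong refl (*-cong (even-comm (d (y j)) (even-yinv i)) refl) ⟨
        d (y i) * ((yinv i * d (y j)) * yinv j)   ≈⟨ *-cong refl (*-assoc _ _ _) ⟩
        d (y i) * (yinv i * (d (y j) * yinv j))   ≈⟨ *-assoc _ _ _ ⟨
        (d (y i) * yinv i) * (d (y j) * yinv j)   ∎

    out inc : (Fin n → Fin n → ℕ) → (Fin n → Carrier) → Carrier
    out M E = ∑ (λ j → times (M k j) (E j))
    inc M E = ∑ (λ i → times (M i k) (E i))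

    Θ′ : (Fin n → Fin m → Fin m → ℕ) → Carrier
    Θ′ N = ∑ (λ i → ∑ (λ j → times (N k i j) (θ i j)))

    Θ′-odd : ∀ N → Odd (Θ′ N)
    Θ′-odd N = odd-∑ λ i → odd-∑ λ j → odd-times (N k i j) (θ-odd i j)

    -- Q splits into the part away from k and E k times (out - in),
    -- using E k E k = 0 and E i E k = - E k E i.
    Q-split : ∀ M E → (∀ i → Odd (E i)) →
              Q M E ≈ Q (away k M) E + E k * (out M E - inc M E)
    Q-split M E odd-E = begin
      ∑ F                                        ≈⟨ ∑-extract k F≈Fᵏ+col at-k≈0 ⟩
      ∑ (λ i → Fᵏ i + colₖ i) + F k              ≈⟨ +-cong (∑-+ Fᵏ colₖ) refl ⟩
      (Q (away k M) E + ∑ colₖ) + F k            ≈⟨ +-cong (+-cong refl colₖ-sum) rowₖ-sum ⟩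
      (Q (away k M) E + - (E k * inc M E)) + E k * out M E
                                                 ≈⟨ +-assoc _ _ _ ⟩
      Q (away k M) E + (- (E k * inc M E) + E k * out M E)
                                                 ≈⟨ +-cong refl (+-comm _ _) ⟩
      Q (away k M) E + (E k * out M E - E k * inc M E)
                                                 ≈⟨ +-cong refl (x[y-z]≈xy-xz _ _ _) ⟨
      Q (away k M) E + E k * (out M E - inc M E) ∎
      where
      F Fᵏ colₖ : Fin n → Carrier
      F i = ∑ (λ j → times (M i j) (E i * E j))
      Fᵏ i = ∑ (λ j → times (away k M i j) (E i * E j))
      colₖ i = times (M i k) (E i * E k)
      F≈Fᵏ+col : ∀ i → i ≢ k → F i ≈ Fᵏ i + colₖ i
      F≈Fᵏ+col i i≢k = ∑-extract k (λ j j≢k → times-≡ _ (P.sym (away-entry k M i≢k j≢k)))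
                              (times-≡ _ (away-col k M i))
      at-k≈0 : Fᵏ k + colₖ k ≈ 0#
      at-k≈0 = begin
        Fᵏ k + colₖ k      ≈⟨ +-cong (∑-cong λ j → times-≡ _ (away-row k M j))
                                     (times-cong (M k k) (odd-sq (odd-E k))) ⟩
        ∑ {n} (λ _ → 0#) + times (M k k) 0#   ≈⟨ +-cong (∑-0 {n}) (times-0 (M k k)) ⟩
        0# + 0#                           ≈⟨ +-identityˡ 0# ⟩
        0#                                ∎
      colₖ-sum : ∑ colₖ ≈ - (E k * inc M E)
      colₖ-sum = ∑-anticommute (λ i → M i k) E (odd-E k) odd-E
      rowₖ-sum : F k ≈ E k * out M E
      rowₖ-sum = trans (∑-cong λ j → sym (times-*ˡ (M k j) (E k) (E j)))
                       (∑-*ˡ (E k) (λ j → times (M k j) (E j)))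

    C-split : ∀ N E → (∀ i → Odd (E i)) → C N E ≈ C (away₃ k N) E + - (E k * Θ′ N)
    C-split N E odd-E = trans (∑-extract k away-from-k at-k) (+-cong refl layerₖ)
      where
      away-from-k : ∀ l → l ≢ k →
        ∑ (λ i → ∑ (λ j → times (N l i j) (θ i j * E l))) ≈
        ∑ (λ i → ∑ (λ j → times (away₃ k N l i j) (θ i j * E l)))
      away-from-k l l≢k = ∑-cong λ i → ∑-cong λ j → times-≡ _ (P.sym (away₃-entry k N i j l≢k))
      at-k : ∑ (λ i → ∑ (λ j → times (away₃ k N k i j) (θ i j * E k))) ≈ 0#
      at-k = trans (∑-cong λ i → trans (∑-cong λ j → times-≡ _ (away₃-at k N i j)) (∑-0 {m})) (∑-0 {m})
      layerₖ : ∑ (λ i → ∑ (λ j → times (N k i j) (θ i j * E k))) ≈ - (E k * Θ′ N)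
      layerₖ = begin
        ∑ (λ i → ∑ (λ j → times (N k i j) (θ i j * E k)))
          ≈⟨ ∑-cong (λ i → ∑-anticommute (N k i) (θ i) (odd-E k) (θ-odd i)) ⟩
        ∑ (λ i → - (E k * Θᵢ i))   ≈⟨ ∑-neg (λ i → E k * Θᵢ i) ⟩
        - ∑ (λ i → E k * Θᵢ i)     ≈⟨ -‿cong (∑-*ˡ (E k) Θᵢ) ⟩
        - (E k * Θ′ N)             ∎
        where
        Θᵢ : Fin m → Carrier
        Θᵢ i = ∑ (λ j → times (N k i j) (θ i j))

    Q-≡ : ∀ {M M′} E → (∀ i j → M i j ≡ M′ i j) → Q M E ≈ Q M′ E
    Q-≡ E M≡M′ = ∑-cong λ i → ∑-cong λ j → times-≡ (E i * E j) (M≡M′ i j)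

    C-≡ : ∀ {N N′} E → (∀ l i j → N l i j ≡ N′ l i j) → C N E ≈ C N′ E
    C-≡ E N≡N′ = ∑-cong λ l → ∑-cong λ i → ∑-cong λ j → times-≡ (θ i j * E l) (N≡N′ l i j)

    Q-merge : ∀ M M′ E → Q M E + Q M′ E ≈ Q (λ i j → M i j +ℕ M′ i j) E
    Q-merge M M′ E = sym (begin
      ∑ (λ i → ∑ (λ j → times (M i j +ℕ M′ i j) (E i * E j)))  ≈⟨ ∑-cong (λ i → ∑-cong λ j → times-+ (M i j) (M′ i j) _) ⟩
      ∑ (λ i → ∑ (λ j → Mᵢ i j + M′ᵢ i j))                      ≈⟨ ∑-cong (λ i → ∑-+ (Mᵢ i) (M′ᵢ i)) ⟩
      ∑ (λ i → ∑ (Mᵢ i) + ∑ (M′ᵢ i))                            ≈⟨ ∑-+ (λ i → ∑ (Mᵢ i)) (λ i → ∑ (M′ᵢ i)) ⟩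
      Q M E + Q M′ E                                            ∎)
      where
      Mᵢ M′ᵢ : Fin n → Fin n → Carrier
      Mᵢ i j = times (M i j) (E i * E j)
      M′ᵢ i j = times (M′ i j) (E i * E j)

    C-merge : ∀ N N′ E → C N E + C N′ E ≈ C (λ l i j → N l i j +ℕ N′ l i j) E
    C-merge N N′ E = sym (begin
      ∑ (λ l → ∑ (λ i → ∑ (λ j → times (N l i j +ℕ N′ l i j) (θ i j * E l))))
        ≈⟨ ∑-cong (λ l → ∑-cong λ i → ∑-cong λ j → times-+ (N l i j) (N′ l i j) _) ⟩
      ∑ (λ l → ∑ (λ i → ∑ (λ j → Nₗ l i j + N′ₗ l i j)))
        ≈⟨ ∑-cong (λ l → ∑-cong λ i → ∑-+ (Nₗ l i) (N′ₗ l i)) ⟩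
      ∑ (λ l → ∑ (λ i → ∑ (Nₗ l i) + ∑ (N′ₗ l i)))
        ≈⟨ ∑-cong (λ l → ∑-+ (λ i → ∑ (Nₗ l i)) (λ i → ∑ (N′ₗ l i))) ⟩
      ∑ (λ l → ∑ (λ i → ∑ (Nₗ l i)) + ∑ (λ i → ∑ (N′ₗ l i)))
        ≈⟨ ∑-+ (λ l → ∑ (λ i → ∑ (Nₗ l i))) (λ l → ∑ (λ i → ∑ (N′ₗ l i))) ⟩
      C N E + C N′ E ∎)
      where
      Nₗ N′ₗ : Fin n → Fin m → Fin m → Carrier
      Nₗ l i j = times (N l i j) (θ i j * E l)
      N′ₗ l i j = times (N′ l i j) (θ i j * E l)

    Q-cancel : ∀ M E → (∀ i → Odd (E i)) → Q (λ i j → M i j ∸ℕ M j i) E ≈ Q M E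
    Q-cancel M E odd-E =
      ∑∑-cancel M (λ i j → E i * E j) (λ i j → odd-anti (odd-E j) (odd-E i)) (λ i → odd-sq (odd-E i))

    C-cancel : ∀ N E → C (λ l i j → N l i j ∸ℕ N l j i) E ≈ C N E
    C-cancel N E = ∑-cong λ l →
      ∑∑-cancel (N l) (λ i j → θ i j * E l)
        (λ i j → trans (*-cong (θ-anti i j) refl) (sym (-‿distribˡ-* _ _)))
        (λ i → trans (*-cong (θ-diag i) refl) (zeroˡ _))

    rest : (Fin n → Fin n → ℕ) → (Fin n → Fin m → Fin m → ℕ) → (Fin n → Carrier) → Carrier
    rest M N E = Q (away k M) E + C (away₃ k N) E

    α : (Fin n → Fin n → ℕ) → (Fin n → Fin m → Fin m → ℕ) → (Fin n → Carrier) → Carrier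
    α M N E = (out M E - inc M E) - Θ′ N

    ω-split : ∀ M N (y yinv : Fin n → Carrier) → (∀ i → Even (y i)) → (∀ i → Even (yinv i)) →
              let E = λ i → dlog (y i) (yinv i) in
              ω M N y yinv ξ ≈ rest M N E + E k * α M N E
    ω-split M N y yinv even-y even-yinv = begin
      ω M N y yinv ξ                                                   ≈⟨ ω≈Q+C M N y yinv even-yinv ⟩
      Q M E + C N E                                                    ≈⟨ +-cong (Q-split M E odd-E) (C-split N E odd-E) ⟩
      (Q (away k M) E + E k * (out M E - inc M E)) + (C (away₃ k N) E + - (E k * Θ′ N))
                                                                       ≈⟨ interchange _ _ _ _ ⟩
      rest M N E + (E k * (out M E - inc M E) - E k * Θ′ N)            ≈⟨ +-cong refl (x[y-z]≈xy-xz _ _ _) ⟨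
      rest M N E + E k * α M N E                                       ∎
      where
      E : Fin n → Carrier
      E i = dlog (y i) (yinv i)
      odd-E : ∀ i → Odd (E i)
      odd-E i = odd-*even (d-even (even-y i)) (even-yinv i)

    rest-local : ∀ M N {E E′ : Fin n → Carrier} → (∀ i → i ≢ k → E i ≈ E′ i) →
                 rest M N E ≈ rest M N E′
    rest-local M N {E} {E′} E≈E′ =
      +-cong (∑-cong λ i → ∑-cong λ j → arrow i j) (∑-cong layer)
      where
      arrow : ∀ i j → times (away k M i j) (E i * E j) ≈ times (away k M i j) (E′ i * E′ j)
      arrow i j with i ≟ k | j ≟ k
      ... | yes _ | _ = refl
      ... | no _ | yes _ = refl
      ... | no i≢k | no j≢k = times-cong (M i j) (*-cong (E≈E′ i i≢k) (E≈E′ j j≢k))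
      layer : ∀ l → ∑ (λ i → ∑ (λ j → times (away₃ k N l i j) (θ i j * E l))) ≈
                    ∑ (λ i → ∑ (λ j → times (away₃ k N l i j) (θ i j * E′ l)))
      layer l with l ≟ k
      ... | yes _ = refl
      ... | no l≢k = ∑-cong λ i → ∑-cong λ j → times-cong (N l i j) (*-cong refl (E≈E′ l l≢k))

  module Mutation {n m : ℕ} (b : Fin n → Fin n → ℕ) (cc : Fin n → Fin m → Fin m → ℕ)
    (quiver : IsExtendedQuiver b cc) (k : Fin n)
    (x xinv : Fin n → Carrier) (ξ : Fin m → Carrier) (x′ x′inv : Carrier)
    (even-x : ∀ i → Even (x i)) (even-xinv : ∀ i → Even (xinv i))
    (x-inv : ∀ i → x i * xinv i ≈ 1#) (odd-ξ : ∀ a → Odd (ξ a))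
    (even-x′ : Even x′) (even-x′inv : Even x′inv) (x′-inv : x′ * x′inv ≈ 1#)
    (exchange-relation : x k * x′ ≈ exchange k b cc x ξ) where

    open IsExtendedQuiver quiver using (no-loops; uniform)
    open SplitAt ξ odd-ξ k

    b′ : Fin n → Fin n → ℕ
    b′ = μQ k b
    c′ : Fin n → Fin m → Fin m → ℕ
    c′ = μc k b cc
    y yinv : Fin n → Carrier
    y = replace x k x′
    yinv = replace xinv k x′inv

    even-y : ∀ i → Even (y i)
    even-y = replace-preserves Even x k x′ even-x′ even-x
    even-yinv : ∀ i → Even (yinv i)
    even-yinv = replace-preserves Even xinv k x′inv even-x′inv even-xinv

    D D′ : Fin n → Carrier
    D i = dlog (x i) (xinv i)
    D′ i = dlog (y i) (yinv i)

    odd-D : ∀ i → Odd (D i)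
    odd-D i = odd-*even (d-even (even-x i)) (even-xinv i)

    D′-away : ∀ i → i ≢ k → D′ i ≈ D i
    D′-away i i≢k rewrite replace-away x k x′ i≢k | replace-away xinv k x′inv i≢k = refl

    D′-at : D′ k ≈ dlog x′ x′inv
    D′-at rewrite replace-at x k x′ | replace-at xinv k x′inv = refl

    a p β α₀ : Carrier
    a = out b D
    p = inc b D
    β = p + Θ′ cc
    α₀ = α b cc D

    odd-a : Odd a
    odd-a = odd-∑ (λ j → odd-times (b k j) (odd-D j))
    odd-β : Odd β
    odd-β = odd-+ (odd-∑ (λ i → odd-times (b i k) (odd-D i))) (Θ′-odd cc)

    α₀≈a-β : α₀ ≈ a - β
    α₀≈a-β = trans (+-assoc _ _ _) (+-cong refl (sym (-‿distrib-+ p (Θ′ cc))))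

    a·α₀ : a * α₀ ≈ - (a * β)
    a·α₀ = begin
      a * α₀              ≈⟨ *-cong refl α₀≈a-β ⟩
      a * (a - β)         ≈⟨ x[y-z]≈xy-xz a a β ⟩
      a * a - a * β       ≈⟨ +-cong (odd-sq odd-a) refl ⟩
      0# - a * β          ≈⟨ +-identityˡ _ ⟩
      - (a * β)           ∎

    β·α₀ : β * α₀ ≈ - (a * β)
    β·α₀ = begin
      β * α₀              ≈⟨ *-cong refl α₀≈a-β ⟩
      β * (a - β)         ≈⟨ x[y-z]≈xy-xz β a β ⟩
      β * a - β * β       ≈⟨ +-cong (odd-anti odd-β odd-a) (-‿cong (odd-sq odd-β)) ⟩
      - (a * β) - 0#      ≈⟨ +-cong refl -0#≈0# ⟩
      - (a * β) + 0#      ≈⟨ +-identityʳ _ ⟩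
      - (a * β)           ∎

    Θ : Carrier
    Θ = ∑ (λ i → ∑ (λ j → times (cc k i j) (ξ i * ξ j)))

    even-Θ : Even Θ
    even-Θ = even-∑ λ i → even-∑ λ j → even-times (cc k i j) (odd-*odd (odd-ξ i) (odd-ξ j))

    dΘ≈Θ′ : d Θ ≈ Θ′ cc
    dΘ≈Θ′ = trans (d-∑ (λ i → ∑ (λ j → times (cc k i j) (ξ i * ξ j))))
                  (∑-cong λ i → trans (d-∑ (λ j → times (cc k i j) (ξ i * ξ j)))
                                      (∑-cong λ j → d-times (cc k i j) (ξ i * ξ j)))

    Θ·Θ′≈0 : Θ * Θ′ cc ≈ 0#
    Θ·Θ′≈0 with two-path-sum-factors (cc k) ξ odd-ξ (uniform k)
    ... | u , v , odd-u , odd-v , Θ≈uv = begin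
      Θ * Θ′ cc              ≈⟨ *-cong refl dΘ≈Θ′ ⟨
      Θ * d Θ                ≈⟨ *-cong Θ≈uv (d-cong Θ≈uv) ⟩
      (u * v) * d (u * v)    ≈⟨ odd-product-dsquare odd-u odd-v ⟩
      0#                     ∎

    Pout Pin W : Carrier
    Pout = ∏ (λ j → x j ^′ b k j)
    Pin = ∏ (λ i → x i ^′ b i k)
    W = (1# + Θ) * Pin

    d-exchange : d (exchange k b cc x ξ) ≈ Pout * a + W * β
    d-exchange = begin
      d (Pout + W)                                  ≈⟨ d-+ Pout W ⟩
      d Pout + d W                                  ≈⟨ +-cong (d-monomial x xinv (b k) even-x x-inv) dW ⟩
      Pout * a + W * β                              ∎
      where
      even-Pin : Even Pin
      even-Pin = even-∏ (λ i → even-^ (even-x i) (b i k))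
      d[1+Θ] : d (1# + Θ) ≈ Θ′ cc
      d[1+Θ] = trans (d-+ 1# Θ) (trans (+-cong d-1 dΘ≈Θ′) (+-identityˡ _))
      -- Θ′ Pin = (1 + Θ) Pin Θ′ because Θ Θ′ = 0
      Θ′·Pin : Θ′ cc * Pin ≈ W * Θ′ cc
      Θ′·Pin = begin
        Θ′ cc * Pin                           ≈⟨ even-comm (Θ′ cc) even-Pin ⟨
        Pin * Θ′ cc                           ≈⟨ +-identityʳ _ ⟨
        Pin * Θ′ cc + 0#                      ≈⟨ +-cong (*-identityˡ _) vanish ⟨
        1# * (Pin * Θ′ cc) + Θ * (Pin * Θ′ cc) ≈⟨ distribʳ _ _ _ ⟨
        (1# + Θ) * (Pin * Θ′ cc)              ≈⟨ *-assoc _ _ _ ⟨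
        W * Θ′ cc                             ∎
        where
        vanish : Θ * (Pin * Θ′ cc) ≈ 0#
        vanish = begin
          Θ * (Pin * Θ′ cc)    ≈⟨ *-assoc _ _ _ ⟨
          (Θ * Pin) * Θ′ cc    ≈⟨ *-cong (even-comm Pin even-Θ) refl ⟩
          (Pin * Θ) * Θ′ cc    ≈⟨ *-assoc _ _ _ ⟩
          Pin * (Θ * Θ′ cc)    ≈⟨ *-cong refl Θ·Θ′≈0 ⟩
          Pin * 0#             ≈⟨ zeroʳ Pin ⟩
          0#                   ∎
      dW : d W ≈ W * β
      dW = begin
        d ((1# + Θ) * Pin)                       ≈⟨ leibniz-even Pin (even-+ even-1 even-Θ) ⟩
        d (1# + Θ) * Pin + (1# + Θ) * d Pin      ≈⟨ +-cong (*-cong d[1+Θ] refl)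
                                                           (*-cong refl (d-monomial x xinv (λ i → b i k) even-x x-inv)) ⟩
        Θ′ cc * Pin + (1# + Θ) * (Pin * p)       ≈⟨ +-cong (sym Θ′·Pin) (*-assoc _ _ _) ⟨
        W * Θ′ cc + W * p                        ≈⟨ +-comm _ _ ⟩
        W * p + W * Θ′ cc                        ≈⟨ distribˡ W p (Θ′ cc) ⟨
        W * β                                    ∎

    -- Multiplying the previous identity by α₀ kills a and β alike.
    d-exchange·α₀ : d (exchange k b cc x ξ) * α₀ ≈ exchange k b cc x ξ * - (a * β)
    d-exchange·α₀ = begin
      d (Pout + W) * α₀                    ≈⟨ *-cong d-exchange refl ⟩
      (Pout * a + W * β) * α₀              ≈⟨ distribʳ α₀ _ _ ⟩
      (Pout * a) * α₀ + (W * β) * α₀       ≈⟨ +-cong (*-assoc _ _ _) (*-assoc _ _ _) ⟩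
      Pout * (a * α₀) + W * (β * α₀)       ≈⟨ +-cong (*-cong refl a·α₀) (*-cong refl β·α₀) ⟩
      Pout * - (a * β) + W * - (a * β)     ≈⟨ distribʳ _ Pout W ⟨
      (Pout + W) * - (a * β)               ∎

    X Xinv : Carrier
    X = x k * x′
    Xinv = xinv k * x′inv

    x′·Xinv : x′ * Xinv ≈ xinv k
    x′·Xinv = begin
      x′ * (xinv k * x′inv)     ≈⟨ *-assoc _ _ _ ⟨
      (x′ * xinv k) * x′inv     ≈⟨ *-cong (even-comm (xinv k) even-x′) refl ⟩
      (xinv k * x′) * x′inv     ≈⟨ *-assoc _ _ _ ⟩
      xinv k * (x′ * x′inv)     ≈⟨ *-cong refl x′-inv ⟩
      xinv k * 1#               ≈⟨ *-identityʳ _ ⟩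
      xinv k                    ∎

    X-inv : X * Xinv ≈ 1#
    X-inv = trans (*-assoc _ _ _) (trans (*-cong refl x′·Xinv) (x-inv k))

    dlog-X : D k + D′ k ≈ dlog X Xinv
    dlog-X = begin
      D k + D′ k                                  ≈⟨ +-cong (sym from-x) (trans D′-at (sym from-x′)) ⟩
      (d (x k) * x′) * Xinv + (x k * d x′) * Xinv ≈⟨ distribʳ Xinv _ _ ⟨
      (d (x k) * x′ + x k * d x′) * Xinv          ≈⟨ *-cong (leibniz-even x′ (even-x k)) refl ⟨
      d X * Xinv                                  ∎
      where
      from-x : (d (x k) * x′) * Xinv ≈ D k
      from-x = trans (*-assoc _ _ _) (*-cong refl x′·Xinv)
      from-x′ : (x k * d x′) * Xinv ≈ dlog x′ x′inv
      from-x′ = begin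
        (x k * d x′) * (xinv k * x′inv)   ≈⟨ *-cong (even-comm (d x′) (even-x k)) refl ⟩
        (d x′ * x k) * (xinv k * x′inv)   ≈⟨ *-assoc _ _ _ ⟩
        d x′ * (x k * (xinv k * x′inv))   ≈⟨ *-cong refl (*-assoc _ _ _) ⟨
        d x′ * ((x k * xinv k) * x′inv)   ≈⟨ *-cong refl (*-cong (x-inv k) refl) ⟩
        d x′ * (1# * x′inv)               ≈⟨ *-cong refl (*-identityˡ _) ⟩
        d x′ * x′inv                      ∎

    exchange-key : (D k + D′ k) * α₀ ≈ - (a * β)
    exchange-key = begin
      (D k + D′ k) * α₀                   ≈⟨ *-cong dlog-X refl ⟩
      (d X * Xinv) * α₀                   ≈⟨ *-assoc _ _ _ ⟩
      d X * (Xinv * α₀)                   ≈⟨ *-cong refl (even-comm α₀ (even-* (even-xinv k) even-x′inv)) ⟩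
      d X * (α₀ * Xinv)                   ≈⟨ *-assoc _ _ _ ⟨
      (d X * α₀) * Xinv                   ≈⟨ *-cong (*-cong (d-cong exchange-relation) refl) refl ⟩
      (d (exchange k b cc x ξ) * α₀) * Xinv ≈⟨ *-cong d-exchange·α₀ refl ⟩
      (exchange k b cc x ξ * - (a * β)) * Xinv ≈⟨ *-cong (*-cong exchange-relation refl) refl ⟨
      (X * - (a * β)) * Xinv              ≈⟨ *-cong (even-comm (- (a * β)) (even-* (even-x k) even-x′)) refl ⟩
      (- (a * β) * X) * Xinv              ≈⟨ *-assoc _ _ _ ⟩
      - (a * β) * (X * Xinv)              ≈⟨ *-cong refl X-inv ⟩
      - (a * β) * 1#                      ≈⟨ *-identityʳ _ ⟩
      - (a * β)                           ∎

    old-coefficient : D k * α₀ ≈ - (a * β) - D′ k * α₀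
    old-coefficient = x+y≈z⇒x≈z-y (trans (sym (distribʳ α₀ (D k) (D′ k))) exchange-key)

    -- At the vertex k the mutation reverses all arrows and 2-paths, so
    -- the coefficient of D′ k in the new form is -α₀.
    D′-weighted : ∀ (f : Fin n → ℕ) → f k ≡ 0 →
                  ∑ (λ j → times (f j) (D′ j)) ≈ ∑ (λ j → times (f j) (D j))
    D′-weighted f fk≡0 = ∑-cong λ j → by-cases j (j ≟ k)
      where
      by-cases : ∀ j → Dec (j ≡ k) → times (f j) (D′ j) ≈ times (f j) (D j)
      by-cases j (yes P.refl) rewrite fk≡0 = refl
      by-cases j (no j≢k) = times-cong (f j) (D′-away j j≢k)

    out-new : out b′ D′ ≈ p
    out-new = trans (∑-cong λ j → times-≡ (D′ j) (μQ-from-k k b j))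
                    (D′-weighted (λ j → b j k) (no-loops k))

    inc-new : inc b′ D′ ≈ a
    inc-new = trans (∑-cong λ i → times-≡ (D′ i) (μQ-to-k k b i))
                    (D′-weighted (λ i → b k i) (no-loops k))

    Θ′-new : Θ′ c′ ≈ - Θ′ cc
    Θ′-new = begin
      ∑ (λ i → ∑ (λ j → times (c′ k i j) (θ i j)))                ≈⟨ C-at-k ⟩
      ∑ (λ i → ∑ (λ j → times (cc k j i ∸ℕ cc k i j) (θ i j)))     ≈⟨ ∑∑-cancel (λ i j → cc k j i) θ θ-anti θ-diag ⟩
      ∑ (λ i → ∑ (λ j → times (cc k j i) (θ i j)))                ≈⟨ ∑-swap (λ i j → times (cc k j i) (θ i j)) ⟩
      ∑ (λ i → ∑ (λ j → times (cc k i j) (θ j i)))                ≈⟨ ∑-cong (λ i → ∑-cong λ j → times-cong (cc k i j) (θ-anti i j)) ⟩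
      ∑ (λ i → ∑ (λ j → times (cc k i j) (- θ i j)))              ≈⟨ ∑-cong (λ i → ∑-cong λ j → times-neg (cc k i j) (θ i j)) ⟩
      ∑ (λ i → ∑ (λ j → - times (cc k i j) (θ i j)))              ≈⟨ ∑∑-neg (λ i j → times (cc k i j) (θ i j)) ⟨
      - Θ′ cc                                                     ∎
      where
      C-at-k : Θ′ c′ ≈ ∑ (λ i → ∑ (λ j → times (cc k j i ∸ℕ cc k i j) (θ i j)))
      C-at-k = ∑-cong λ i → ∑-cong λ j → times-≡ (θ i j) (μc-at-k k b cc i j)

    α-new : α b′ c′ D′ ≈ - α₀
    α-new = begin
      (out b′ D′ - inc b′ D′) - Θ′ c′     ≈⟨ +-cong (+-cong out-new (-‿cong inc-new)) (-‿cong Θ′-new) ⟩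
      (p - a) - - Θ′ cc                   ≈⟨ +-cong (+-comm p (- a)) refl ⟩
      (- a + p) - - Θ′ cc                 ≈⟨ +-cong (+-cong refl (-‿involutive p)) refl ⟨
      (- a + - - p) + - - Θ′ cc           ≈⟨ +-cong (-‿distrib-+ a (- p)) refl ⟨
      - (a - p) + - - Θ′ cc               ≈⟨ -‿distrib-+ (a - p) (- Θ′ cc) ⟨
      - α₀                                ∎

    new-coefficient : - (D′ k * α₀) ≈ D′ k * α b′ c′ D′
    new-coefficient = trans (-‿distribʳ-* (D′ k) α₀) (*-cong refl (sym α-new))

    -- Away from k, -(a β) supplies exactly the arrows i → k → j of (0)
    -- and the 2-paths of (1*).
    -a·p : - (a * p) ≈ Q (λ i j → b i k *ℕ b k j) D
    -a·p = begin
      - (a * p)                           ≈⟨ -‿cong (∑-product t s) ⟩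
      - ∑ (λ j → ∑ (λ i → t j * s i))     ≈⟨ -‿cong (∑-swap (λ j i → t j * s i)) ⟩
      - ∑ (λ i → ∑ (λ j → t j * s i))     ≈⟨ ∑∑-neg (λ i j → t j * s i) ⟩
      ∑ (λ i → ∑ (λ j → - (t j * s i)))   ≈⟨ ∑-cong (λ i → ∑-cong λ j → anticommute-times (b k j) (b i k) (odd-D j) (odd-D i)) ⟩
      Q (λ i j → b i k *ℕ b k j) D        ∎
      where
      t s : Fin n → Carrier
      t j = times (b k j) (D j)
      s i = times (b i k) (D i)

    -a·Θ′ : - (a * Θ′ cc) ≈ C (λ l i j → cc k i j *ℕ b k l) D
    -a·Θ′ = begin
      - (a * Θ′ cc)                                   ≈⟨ -‿cong (∑-*ʳ (Θ′ cc) t) ⟨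
      - ∑ (λ l → t l * Θ′ cc)                         ≈⟨ -‿cong (∑-cong expand) ⟩
      - ∑ (λ l → ∑ (λ i → ∑ (λ j → t l * s i j)))     ≈⟨ ∑-neg (λ l → ∑ (λ i → ∑ (λ j → t l * s i j))) ⟨
      ∑ (λ l → - ∑ (λ i → ∑ (λ j → t l * s i j)))     ≈⟨ ∑-cong (λ l → ∑∑-neg (λ i j → t l * s i j)) ⟩
      ∑ (λ l → ∑ (λ i → ∑ (λ j → - (t l * s i j))))
        ≈⟨ ∑-cong (λ l → ∑-cong λ i → ∑-cong λ j → anticommute-times (b k l) (cc k i j) (odd-D l) (θ-odd i j)) ⟩
      C (λ l i j → cc k i j *ℕ b k l) D               ∎
      where
      t : Fin n → Carrier
      t l = times (b k l) (D l)
      s : Fin m → Fin m → Carrier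
      s i j = times (cc k i j) (θ i j)
      expand : ∀ l → t l * Θ′ cc ≈ ∑ (λ i → ∑ (λ j → t l * s i j))
      expand l = sym (trans (∑-cong λ i → ∑-*ˡ (t l) (s i)) (∑-*ˡ (t l) (λ i → ∑ (s i))))

    quiver-mutation : rest b cc D + - (a * β) ≈ rest b′ c′ D′
    quiver-mutation = begin
      rest b cc D + - (a * β)
        ≈⟨ +-cong refl -a·β ⟩
      (Q (away k b) D + C (away₃ k cc) D) + (Q (λ i j → b i k *ℕ b k j) D + C (λ l i j → cc k i j *ℕ b k l) D)
        ≈⟨ interchange _ _ _ _ ⟩
      (Q (away k b) D + Q (λ i j → b i k *ℕ b k j) D) + (C (away₃ k cc) D + C (λ l i j → cc k i j *ℕ b k l) D)
        ≈⟨ +-cong (Q-merge (away k b) _ D) (C-merge (away₃ k cc) _ D) ⟩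
      Q (composed k b) D + C (completed k b cc) D
        ≈⟨ +-cong (Q-cancel (composed k b) D odd-D) (C-cancel (completed k b cc) D) ⟨
      Q (λ i j → composed k b i j ∸ℕ composed k b j i) D
        + C (λ l i j → completed k b cc l i j ∸ℕ completed k b cc l j i) D
        ≈⟨ +-cong (Q-≡ D (λ i j → P.sym (away-μQ k b (no-loops k) i j)))
                  (C-≡ D (λ l i j → P.sym (away₃-μc k b cc (no-loops k) l i j))) ⟩
      rest b′ c′ D
        ≈⟨ rest-local b′ c′ (λ i i≢k → sym (D′-away i i≢k)) ⟩
      rest b′ c′ D′ ∎
      where
      -a·β : - (a * β) ≈ Q (λ i j → b i k *ℕ b k j) D + C (λ l i j → cc k i j *ℕ b k l) D
      -a·β = trans (-‿cong (distribˡ a p (Θ′ cc))) (trans (-‿distrib-+ _ _) (+-cong -a·p -a·Θ′))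

theorem3p4 : ∀ {c ℓ : Level} (S : SuperDGA c ℓ) {n m : ℕ}
    (b : Fin n → Fin n → ℕ) (cc : Fin n → Fin m → Fin m → ℕ)
    → IsExtendedQuiver b cc
    → (k : Fin n)
    → (x xinv : Fin n → SuperDGA.Carrier S) (ξ : Fin m → SuperDGA.Carrier S)
    → (x′ x′inv : SuperDGA.Carrier S)
    → (∀ i → SuperDGA.Even S (x i))
    → (∀ i → SuperDGA.Even S (xinv i))
    → (∀ i → SuperDGA._≈_ S (SuperDGA._*_ S (x i) (xinv i)) (SuperDGA.1# S))
    → (∀ a → SuperDGA.Odd S (ξ a))
    → SuperDGA.Even S x′
    → SuperDGA.Even S x′inv
    → SuperDGA._≈_ S (SuperDGA._*_ S x′ x′inv) (SuperDGA.1# S)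
    → SuperDGA._≈_ S (SuperDGA._*_ S (x k) x′) (Forms.exchange S k b cc x ξ)
    → SuperDGA._≈_ S (Forms.ω S b cc x xinv ξ)
        (Forms.ω S (μQ k b) (μc k b cc) (replace x k x′) (replace xinv k x′inv) ξ)
theorem3p4 S b cc quiver k x xinv ξ x′ x′inv
           even-x even-xinv x-inv odd-ξ even-x′ even-x′inv x′-inv exchange-relation = begin
  ω b cc x xinv ξ                              ≈⟨ ω-split b cc x xinv even-x even-xinv ⟩
  rest b cc D + D k * α₀                       ≈⟨ +-cong refl old-coefficient ⟩
  rest b cc D + (- (a * β) - D′ k * α₀)        ≈⟨ +-assoc _ _ _ ⟨
  (rest b cc D + - (a * β)) - D′ k * α₀        ≈⟨ +-cong quiver-mutation new-coefficient ⟩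
  rest b′ c′ D′ + D′ k * α b′ c′ D′            ≈⟨ ω-split b′ c′ y yinv even-y even-yinv ⟨
  ω b′ c′ y yinv ξ                             ∎
  where
  open Invariance S
  open SuperDGA S hiding (zero)
  open Forms S using (ω)
  open Mutation b cc quiver k x xinv ξ x′ x′inv
                even-x even-xinv x-inv odd-ξ even-x′ even-x′inv x′-inv exchange-relation
  open SplitAt ξ odd-ξ k using (rest; α; ω-split)
  open import Relation.Binary.Reasoning.Setoid setoid
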